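{- Let $\mathcal{K}=\langle W,\preceq,D,I\rangle$ be a Kripke model, $w_\star\in W$, and let $W'$, $\preceq'$, $D'$, $w'_\star$ and $D''$ be as defined in the context. Let $F_1,\dots,F_n\in D''$ (with $n\ge 0$, where for $n=0$ the intersection $\bigcap_{i=1}^n \mathrm{dom}(F_i)$ denotes $W'$). Then: (i) $\bigcap_{i=1}^n\mathrm{dom}(F_i)$ is an upward-closed subset of $W'$; (ii) for every $w'\in W'$, $\bigcap_{i=1}^n\mathrm{dom}(F_i)$ bars $w'$.
   Context: A Kripke model $\langle W,\preceq,D,I\rangle$ consists of a preorder $\preceq$ on $W$, nonempty sets $D(w)$ with $D(w)\subseteq D(v)$ for $w\preceq v$, and hereditary interpretations $I(w,p):D(w)^n\to\{0,1\}$ of $n$-ary predicate symbols $p$. $W'$ is the set of finite sequences $\langle w_\star,w_1,\dots,w_n\rangle$ ($n\ge0$, $w_i\in W$) with $w_\star\preceq w_1\preceq\cdots\preceq w_n$; $w'\preceq' v'$ iff $w'$ is an initial segment of $v'$; $w'_\star=\langle w_\star\rangle$. $\mathrm{Last}(w')$ is the last component of $w'$, and $D'(w')=D(\mathrm{Last}(w'))$. In a preordered set $\langle A,\preceq\rangle$, a path from $a\in A$ is a maximal linearly ordered subset of $\{b\in A\mid b\succeq a\}$; a set $B\subseteq A$ bars $a$ if every path from $a$ meets $B$. $D''$ is the set of partial functions $F$ from $W'$ to $\bigcup_{w'\in W'}D'(w')$ such that: $\mathrm{dom}(F)$ bars $w'_\star$; $\mathrm{dom}(F)$ is upward-closed in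 $W'$; $F(w')\in D'(w')$ for all $w'\in\mathrm{dom}(F)$; and if $w'\in\mathrm{dom}(F)$ and $w'\preceq'v'$ then $F(w')=F(v')$. -}

module Defs where

open import Level using (0ℓ)
open import Data.Nat using (ℕ)
open import Data.Bool using (Bool; true)
open import Data.Unit using (⊤)
open import Data.Product using (Σ; ∃; _×_; _,_; proj₁; proj₂)
open import Data.Sum using (_⊎_)
open import Data.List using (List; []; _∷_; _++_)
open import Data.Vec using (Vec)
open import Data.Vec.Relation.Unary.All using (All)
open import Relation.Unary using (Pred; _∈_; _⊆_)
open import Relation.Binary using (Rel; IsPreorder)
open import Relation.Binary.PropositionalEquality using (_≡_)

module _ {A : Set} (_≼_ : Rel A 0ℓ) where

  IsChain : Pred A 0ℓ → Set
  IsChain B = ∀ x y → x ∈ B → y ∈ B → (x ≼ y) ⊎ (y ≼ x)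

  AboveOf : A → Pred A 0ℓ → Set
  AboveOf a B = ∀ x → x ∈ B → a ≼ x

  IsPath : A → Pred A 0ℓ → Set₁
  IsPath a P = AboveOf a P × IsChain P
             × (∀ (Q : Pred A 0ℓ) → AboveOf a Q → IsChain Q → P ⊆ Q → Q ⊆ P)

  Bars : Pred A 0ℓ → A → Set₁
  Bars B a = ∀ (P : Pred A 0ℓ) → IsPath a P → ∃ λ b → b ∈ P × b ∈ B

  UpwardClosed : Pred A 0ℓ → Set
  UpwardClosed B = ∀ x y → x ∈ B → x ≼ y → y ∈ B

record KripkeModel : Set₁ where
  field
    W       : Set
    _≼_     : Rel W 0ℓ
    isPreorder : IsPreorder _≡_ _≼_
    U       : Set
    D       : W → Pred U 0ℓ
    D-nonempty : ∀ w → ∃ λ x → x ∈ D w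
    D-mono  : ∀ {w v} → w ≼ v → D w ⊆ D v
    PredSym : Set
    arity   : PredSym → ℕ
    I       : (w : W) (p : PredSym) (ds : Vec U (arity p)) → All (λ d → d ∈ D w) ds → Bool
    I-hered : ∀ {w v} (w≼v : w ≼ v) (p : PredSym) (ds : Vec U (arity p))
                (h : All (λ d → d ∈ D w) ds) (h' : All (λ d → d ∈ D v) ds) →
                I w p ds h ≡ true → I v p ds h' ≡ true

module Construction (K : KripkeModel) (w⋆ : KripkeModel.W K) where
  open KripkeModel K

  Chain : W → List W → Set
  Chain a []       = ⊤
  Chain a (b ∷ bs) = (a ≼ b) × Chain b bs

  -- ⟨w⋆, w₁, …, wₙ⟩ is represented by the list [w₁, …, wₙ]
  W′ : Set
  W′ = Σ (List W) (Chain w⋆)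

  _≼′_ : Rel W′ 0ℓ
  w′ ≼′ v′ = ∃ λ (s : List W) → proj₁ v′ ≡ proj₁ w′ ++ s

  w′⋆ : W′
  w′⋆ = [] , _

  lastFrom : W → List W → W
  lastFrom a []       = a
  lastFrom a (b ∷ bs) = lastFrom b bs

  Last : W′ → W
  Last w′ = lastFrom w⋆ (proj₁ w′)

  D′ : W′ → Pred U 0ℓ
  D′ w′ = D (Last w′)

  -- elements of D'': partial functions W' ⇀ ⋃ D'(w')
  record D″ : Set₁ where
    field
      dom    : Pred W′ 0ℓ
      fun    : (w′ : W′) → w′ ∈ dom → U
      dom-bars   : Bars _≼′_ dom w′⋆
      dom-up     : UpwardClosed _≼′_ dom
      fun-in-D′  : ∀ w′ (h : w′ ∈ dom) → fun w′ h ∈ D′ w′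
      fun-const  : ∀ w′ v′ (h : w′ ∈ dom) (h' : v′ ∈ dom) → w′ ≼′ v′ →
                   fun w′ h ≡ fun v′ h'

-- A path from w′ in W′ together with all initial segments of w′ is a path
-- from the root w′⋆, since the initial segments of a sequence form a chain.
-- Hence a domain that bars w′⋆ meets every path from w′ as well, and being
-- upward closed it meets it in a final segment of the path.  Finitely many
-- final segments of a chain have a common point, so the intersection of the
-- domains bars w′ too.
module Submission where

open import Level using (0ℓ)
open import Data.Nat using (ℕ; zero; suc)
open import Data.Fin using (Fin; zero; suc)
open import Data.Product using (_×_; _,_; ∃; proj₁; proj₂)
open import Data.Sum using (_⊎_; inj₁; inj₂)
open import Data.List using (List; []; _∷_; _++_)
open import Data.List.Properties using (++-assoc; ++-identityʳ; ∷-injective)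
open import Relation.Unary using (Pred; _∈_)
open import Relation.Binary using (Rel; Reflexive; Transitive)
open import Relation.Binary.PropositionalEquality
  using (_≡_; refl; sym; trans; cong)

open import Defs

module PreorderPaths {A : Set} {_≤_ : Rel A 0ℓ}
                     (≤-refl : Reflexive _≤_) (≤-trans : Transitive _≤_) where

  ⋂ : ∀ {n} → (Fin n → Pred A 0ℓ) → Pred A 0ℓ
  ⋂ B x = ∀ i → B i x

  ⋂-upwardClosed : ∀ {n} (B : Fin n → Pred A 0ℓ) →
                   (∀ i → UpwardClosed _≤_ (B i)) → UpwardClosed _≤_ (⋂ B)
  ⋂-upwardClosed B up x y x∈B x≤y i = up i x y (x∈B i) x≤y

  path-∋-start : ∀ {a P} → IsPath _≤_ a P → a ∈ P
  path-∋-start {a} {P} (above , chain , maximal) =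
    maximal P∪a above∪a chain∪a inj₁ (inj₂ refl)
    where
    P∪a : Pred A 0ℓ
    P∪a x = P x ⊎ x ≡ a

    above∪a : AboveOf _≤_ a P∪a
    above∪a x (inj₁ x∈P) = above x x∈P
    above∪a x (inj₂ refl) = ≤-refl

    chain∪a : IsChain _≤_ P∪a
    chain∪a x y (inj₁ x∈P) (inj₁ y∈P) = chain x y x∈P y∈P
    chain∪a x y (inj₁ x∈P) (inj₂ refl) = inj₂ (above x x∈P)
    chain∪a x y (inj₂ refl) (inj₁ y∈P) = inj₁ (above y y∈P)
    chain∪a x y (inj₂ refl) (inj₂ refl) = inj₁ ≤-refl

  bars-⋂ : ∀ {n a} (B : Fin n → Pred A 0ℓ) → (∀ i → UpwardClosed _≤_ (B i)) →
           (∀ i → Bars _≤_ (B i) a) → Bars _≤_ (⋂ B) a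
  bars-⋂ {zero} B up bars P path = _ , path-∋-start path , λ ()
  bars-⋂ {suc n} B up bars P path@(_ , chain , _)
    with bars zero P path | bars-⋂ (λ i → B (suc i)) (λ i → up (suc i)) (λ i → bars (suc i)) P path
  ... | b , b∈P , b∈B₀ | c , c∈P , c∈⋂B₊ with chain b c b∈P c∈P
  ... | inj₁ b≤c = c , c∈P , λ { zero → up zero b c b∈B₀ b≤c ; (suc i) → c∈⋂B₊ i }
  ... | inj₂ c≤b = b , b∈P , λ { zero → b∈B₀ ; (suc i) → up (suc i) c b (c∈⋂B₊ i) c≤b }

  module Tree (r : A) (r-least : ∀ x → r ≤ x)
              (below-linear : ∀ {x y z} → x ≤ z → y ≤ z → (x ≤ y) ⊎ (y ≤ x)) where

    path-extendToRoot : ∀ {a P} → IsPath _≤_ a P → IsPath _≤_ r (λ x → P x ⊎ x ≤ a)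
    path-extendToRoot {a} {P} path@(above , chain , maximal) =
      (λ x _ → r-least x) , chain↓a , maximal↓a
      where
      P↓a : Pred A 0ℓ
      P↓a x = P x ⊎ x ≤ a

      chain↓a : IsChain _≤_ P↓a
      chain↓a x y (inj₁ x∈P) (inj₁ y∈P) = chain x y x∈P y∈P
      chain↓a x y (inj₁ x∈P) (inj₂ y≤a) = inj₂ (≤-trans y≤a (above x x∈P))
      chain↓a x y (inj₂ x≤a) (inj₁ y∈P) = inj₁ (≤-trans x≤a (above y y∈P))
      chain↓a x y (inj₂ x≤a) (inj₂ y≤a) = below-linear x≤a y≤a

      -- An element x of a larger chain Q is comparable with a ∈ Q; if a ≤ x,
      -- then x ∈ P by maximality of P, as Q ∩ ↑a is a chain above a containing P.
      maximal↓a : ∀ Q → AboveOf _≤_ r Q → IsChain _≤_ Q →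
                  (∀ {x} → P↓a x → Q x) → ∀ {x} → Q x → P↓a x
      maximal↓a Q _ chainQ P↓a⊆Q {x} x∈Q with chainQ x a x∈Q (P↓a⊆Q (inj₁ (path-∋-start path)))
      ... | inj₁ x≤a = inj₂ x≤a
      ... | inj₂ a≤x = inj₁ (maximal (λ y → Q y × a ≤ y) (λ _ → proj₂)
                                     (λ y z y∈Q z∈Q → chainQ y z (proj₁ y∈Q) (proj₁ z∈Q))
                                     (λ {y} y∈P → P↓a⊆Q (inj₁ y∈P) , above y y∈P)
                                     (x∈Q , a≤x))

    bars-root⇒bars : ∀ {B a} → UpwardClosed _≤_ B → Bars _≤_ B r → Bars _≤_ B a
    bars-root⇒bars {B} {a} up barsRoot P path
      with barsRoot _ (path-extendToRoot path)
    ... | b , inj₁ b∈P , b∈B = b , b∈P , b∈B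
    ... | b , inj₂ b≤a , b∈B = a , path-∋-start path , up b a b∈B b≤a

prefixes-comparable : ∀ {A : Set} (xs ys s t : List A) → xs ++ s ≡ ys ++ t →
                      (∃ λ u → ys ≡ xs ++ u) ⊎ (∃ λ u → xs ≡ ys ++ u)
prefixes-comparable []       ys       s t eq = inj₁ (ys , refl)
prefixes-comparable (x ∷ xs) []       s t eq = inj₂ (x ∷ xs , refl)
prefixes-comparable (x ∷ xs) (y ∷ ys) s t eq with ∷-injective eq
... | refl , eq′ with prefixes-comparable xs ys s t eq′
... | inj₁ (u , ys≡xs++u) = inj₁ (u , cong (x ∷_) ys≡xs++u)
... | inj₂ (u , xs≡ys++u) = inj₂ (u , cong (x ∷_) xs≡ys++u)

module InitialSegments (K : KripkeModel) (w⋆ : KripkeModel.W K) where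
  open Construction K w⋆

  ≼′-refl : Reflexive _≼′_
  ≼′-refl {w′} = [] , sym (++-identityʳ (proj₁ w′))

  ≼′-trans : Transitive _≼′_
  ≼′-trans {u′} (s , v≡u++s) (t , w≡v++t) =
    s ++ t , trans w≡v++t (trans (cong (_++ t) v≡u++s) (++-assoc (proj₁ u′) s t))

  w′⋆-least : ∀ w′ → w′⋆ ≼′ w′
  w′⋆-least w′ = proj₁ w′ , refl

  ≼′-below-linear : ∀ {u′ v′ w′} → u′ ≼′ w′ → v′ ≼′ w′ → (u′ ≼′ v′) ⊎ (v′ ≼′ u′)
  ≼′-below-linear {u′} {v′} (s , w≡u++s) (t , w≡v++t) =
    prefixes-comparable (proj₁ u′) (proj₁ v′) s t (trans (sym w≡u++s) w≡v++t)

  open PreorderPaths (λ {x} → ≼′-refl {x}) (λ {x y z} → ≼′-trans {x} {y} {z}) public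
  open Tree w′⋆ w′⋆-least (λ {u′ v′ w′} → ≼′-below-linear {u′} {v′} {w′}) public

lemma3 : (K : KripkeModel) (w⋆ : KripkeModel.W K) →
         let open Construction K w⋆ in
         (n : ℕ) (F : Fin n → D″) →
         UpwardClosed _≼′_ (λ w′ → ∀ i → D″.dom (F i) w′)
         × (∀ (w′ : W′) → Bars _≼′_ (λ w′ → ∀ i → D″.dom (F i) w′) w′)
lemma3 K w⋆ n F =
  ⋂-upwardClosed dom (λ i → D″.dom-up (F i)) ,
  λ w′ → bars-⋂ {a = w′} dom (λ i → D″.dom-up (F i))
                    (λ i → bars-root⇒bars {a = w′} (D″.dom-up (F i)) (D″.dom-bars (F i)))
  where
  open Construction K w⋆
  open InitialSegments K w⋆

  dom : Fin n → Pred W′ 0ℓ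
  dom i = D″.dom (F i)
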